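{- Let $X$ be an $n$-element set with $n\ge1$, let $0\le k\le n$, and let $\pi_0\in\Pi_l(X)$ be the labelled set partition of $X$ into singletons of which exactly $k$ are labelled. Let $P(n,k)$ be the number of $\pi\in\Pi_l(X)$ with $\pi\ge\pi_0$ having at least one labelled block. Then \[ P(n,0)=\sum_{j=1}^{n}\binom{n}{j}B(j)B(n-j),\qquad P(n,k)=\sum_{j=0}^{n-k}\binom{n-k}{j}B(k+j)B(n-k-j)\ \text{ for }k\ge1, \] where $B(m)$ is the $m$-th Bell number (number of set partitions of an $m$-element set, $B(0)=1$).
   Context: For a finite set $X$ and a symbol $l\notin X$, a labelled set partition of $X$ is a collection $\pi=\{B_1\cup L_1,\dots,B_k\cup L_k\}$ where $\{B_1,\dots,B_k\}$ is a set partition of $X$ and each $L_i\in\{\emptyset,\{l\}\}$ (labelled block if $L_i=\{l\}$, unlabelled otherwise). $\Pi_l(X)$ is the set of all such, partially ordered by $\sigma\le\pi$ iff every block of $\sigma$ (as a set, including $l$ if present) is contained in some block of $\pi$. -}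

module Defs where

open import Data.Nat using (ℕ; zero; suc; _+_; _*_; _∸_)
open import Data.Nat.Combinatorics using (_C_)
open import Data.Bool using (Bool; true; false; T)
open import Data.Bool.Properties using () renaming (_≟_ to _≟ᵇ_)
open import Data.Fin using (Fin)
open import Data.Fin.Properties using (all?; any?)
open import Data.Fin.Subset using (Subset; _∈_; _⊆_; ⁅_⁆)
open import Data.Fin.Subset.Properties using (_∈?_; _⊆?_)
open import Data.Vec using (Vec; []; _∷_; lookup; tabulate)
import Data.Vec.Properties as VecP
import Data.Product.Properties as ProdP
open import Data.List using (List; []; _∷_; length; filter; concatMap; map; upTo)
open import Data.Nat.ListAction using (sum)
open import Data.Product using (_×_; _,_; proj₁; proj₂; ∃)
open import Data.Unit using (tt)
open import Relation.Nullary using (Dec; yes; no)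
open import Relation.Nullary.Decidable using (_×-dec_; _→-dec_)
open import Relation.Binary.PropositionalEquality using (_≡_)
open import Relation.Binary.Definitions using (DecidableEquality)

allVecs : ∀ {A : Set} → List A → (n : ℕ) → List (Vec A n)
allVecs xs zero    = [] ∷ []
allVecs xs (suc n) = concatMap (λ a → map (a ∷_) (allVecs xs n)) xs

allBools : List Bool
allBools = true ∷ false ∷ []

-- A set partition is represented faithfully and canonically by the map
-- x ↦ (the block containing x).  The blocks of the partition are exactly
-- the sets  lookup β x.

PartRep : ℕ → Set
PartRep m = Vec (Subset m) m

IsSetPartition : ∀ {m} → PartRep m → Set
IsSetPartition {m} β =
  (x : Fin m) → (x ∈ lookup β x) × ((y : Fin m) → y ∈ lookup β x → lookup β y ≡ lookup β x)

isSetPartition? : ∀ {m} (β : PartRep m) → Dec (IsSetPartition β)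
isSetPartition? {m} β =
  all? λ x → (x ∈? lookup β x) ×-dec
             all? (λ y → (y ∈? lookup β x) →-dec VecP.≡-dec _≟ᵇ_ (lookup β y) (lookup β x))

Bell : ℕ → ℕ
Bell m = length (filter isSetPartition? (allVecs (allVecs allBools m) m))

-- Labelled set partitions of X = Fin n with label symbol l.
-- A block B ∪ L is a pair (B , b) with B ⊆ X and b = true iff L = {l}.

Block : ℕ → Set
Block n = Subset n × Bool

_≟Block_ : ∀ {n} → DecidableEquality (Block n)
_≟Block_ = ProdP.≡-dec (VecP.≡-dec _≟ᵇ_) _≟ᵇ_

-- containment of blocks as subsets of X ∪ {l}
_⊑_ : ∀ {n} → Block n → Block n → Set
(B , a) ⊑ (C , c) = (B ⊆ C) × (T a → T c)

_⊑?_ : ∀ {n} (b c : Block n) → Dec (b ⊑ c)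
(B , a) ⊑? (C , c) = (B ⊆? C) ×-dec (T? a →-dec T? c)
  where
  T? : (b : Bool) → Dec (T b)
  T? true  = yes tt
  T? false = no λ ()

-- Representation of a labelled set partition π: the map x ↦ (block of π
-- containing x).  The blocks of π are exactly the values  lookup π x.
-- Blocks need not have distinct labels: any number of blocks may be labelled.
LPRep : ℕ → Set
LPRep n = Vec (Block n) n

IsLabelledSetPartition : ∀ {n} → LPRep n → Set
IsLabelledSetPartition {n} π =
  (x : Fin n) → (x ∈ proj₁ (lookup π x)) ×
                ((y : Fin n) → y ∈ proj₁ (lookup π x) → lookup π y ≡ lookup π x)

isLabelledSetPartition? : ∀ {n} (π : LPRep n) → Dec (IsLabelledSetPartition π)
isLabelledSetPartition? {n} π =
  all? λ x → (x ∈? proj₁ (lookup π x)) ×-dec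
             all? (λ y → (y ∈? proj₁ (lookup π x)) →-dec (lookup π y ≟Block lookup π x))

_≤ₗ_ : ∀ {n} → LPRep n → LPRep n → Set
_≤ₗ_ {n} σ π = (x : Fin n) → ∃ λ (y : Fin n) → lookup σ x ⊑ lookup π y

_≤ₗ?_ : ∀ {n} (σ π : LPRep n) → Dec (σ ≤ₗ π)
σ ≤ₗ? π = all? λ x → any? λ y → lookup σ x ⊑? lookup π y

HasLabelledBlock : ∀ {n} → LPRep n → Set
HasLabelledBlock {n} π = ∃ λ (x : Fin n) → T (proj₂ (lookup π x))

hasLabelledBlock? : ∀ {n} (π : LPRep n) → Dec (HasLabelledBlock π)
hasLabelledBlock? π = any? λ x → T? (proj₂ (lookup π x))
  where
  T? : (b : Bool) → Dec (T b)
  T? true  = yes tt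
  T? false = no λ ()

π₀ : ∀ {n} → Subset n → LPRep n
π₀ K = tabulate λ x → (⁅ x ⁆ , lookup K x)

P : ∀ {n} → Subset n → ℕ
P {n} K = length (filter (λ π → isLabelledSetPartition? π ×-dec
                                 (π₀ K ≤ₗ? π) ×-dec hasLabelledBlock? π)
                         (allVecs (concatMap (λ B → map (B ,_) allBools)
                                             (allVecs allBools n)) n))

Σ[_≤j≤_] : ℕ → ℕ → (ℕ → ℕ) → ℕ
Σ[ a ≤j≤ b ] f = sum (map (λ i → f (a + i)) (upTo (suc b ∸ a)))

module Submission where

-- A labelled partition π ≥ π₀(K) is determined by three pieces of data: the
-- set L of points lying in labelled blocks, the partition of L formed by the
-- labelled blocks, and the partition of X ∖ L formed by the unlabelled ones.
-- The condition π ≥ π₀(K) says exactly K ⊆ L, and "π has a labelled block"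
-- says L ≠ ∅.  Hence
--     P(K) = Σ_{L ⊇ K, L ≠ ∅} B(|L|) · B(n − |L|),
-- and grouping the supersets L by |L| = |K| + j yields the binomial sums of
-- the theorem; for K = ∅ the excluded set L = ∅ is the term j = 0.

open import Defs
open import Data.Nat using (ℕ; _≤_; _+_; _*_; _∸_)
open import Data.Nat.Combinatorics using (_C_)
open import Data.Fin.Subset using (Subset; ∣_∣)
open import Data.Product using (_×_)
open import Relation.Binary.PropositionalEquality using (_≡_)

open import Data.Bool using (Bool; true; false; not; T; if_then_else_)
import Data.Bool.Properties as Boolₚ
open import Data.Fin using (Fin; zero; suc; punchIn; punchOut)
import Data.Fin.Properties as Finₚ
open import Data.Fin.Subset using (_∈_; _⊆_; ∁; ⁅_⁆; ⊥; ⊤; Nonempty)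
open import Data.Fin.Subset.Properties
  using (_∈?_; _⊆?_; ∉⊥; ∣⊤∣≡n; ∣⊥∣≡0; ∣p∣≤n; ∣∁p∣≡n∸∣p∣; in⊆in-⇔; out⊆-⇔;
         x∈⁅x⁆; x∈⁅y⁆⇒x≡y; nonempty?; Empty-unique; x∈p⇒∣p-x∣<∣p∣)
open import Data.List using (List; []; _∷_; _++_; map; concatMap; length; filter; applyUpTo)
open import Data.List.Properties using (map-++; map-cong; map-∘)
open import Data.Nat using (zero; suc; s≤s; z≤n; _≤?_)
open import Data.Nat.Combinatorics using (k>n⇒nCk≡0; nCk+nC[k+1]≡[n+1]C[k+1])
open import Data.Nat.ListAction using (sum)
open import Data.Nat.ListAction.Properties using (sum-++)
open import Data.Nat.Properties
open import Algebra.Properties.CommutativeSemigroup +-commutativeSemigroup using (interchange; x∙yz≈y∙xz)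
open import Data.Product using (_,_; proj₁; proj₂; ∃)
import Data.Product.Properties as Productₚ
open import Data.Sum using (_⊎_; inj₁; inj₂)
open import Data.Vec using (Vec; []; _∷_; lookup; tabulate; insertAt; removeAt; here)
import Data.Vec as Vec
import Data.Vec.Properties as Vecₚ
open import Function using (case_of_)
open import Function.Bundles using (Equivalence)
open import Relation.Binary.Definitions using (DecidableEquality)
open import Relation.Binary.PropositionalEquality
  using (refl; sym; trans; cong; cong₂; subst; ≢-sym; module ≡-Reasoning)
open import Relation.Nullary using (Dec; yes; no; ¬_; _because_; contradiction)
open import Relation.Nullary.Decidable using (_×-dec_; _→-dec_)

private variable
  A B D : Set

𝟙 : Dec A → ℕ
𝟙 (true because _) = 1
𝟙 (false because _) = 0

𝟙-yes : A → (d : Dec A) → 𝟙 d ≡ 1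
𝟙-yes a (yes _) = refl
𝟙-yes a (no ¬a) = contradiction a ¬a

𝟙-no : ¬ A → (d : Dec A) → 𝟙 d ≡ 0
𝟙-no ¬a (yes a) = contradiction a ¬a
𝟙-no ¬a (no _) = refl

𝟙-⇔ : (A → B) → (B → A) → (d : Dec A) (e : Dec B) → 𝟙 d ≡ 𝟙 e
𝟙-⇔ to from (yes a) e = sym (𝟙-yes (to a) e)
𝟙-⇔ to from (no ¬a) e = sym (𝟙-no (λ b → ¬a (from b)) e)

𝟙-× : (d : Dec A) (e : Dec B) → 𝟙 (d ×-dec e) ≡ 𝟙 d * 𝟙 e
𝟙-× (yes a) (yes b) = refl
𝟙-× (yes a) (no b) = refl
𝟙-× (no a) e = refl

∑ : List A → (A → ℕ) → ℕ
∑ xs h = sum (map h xs)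

∑-cong : (xs : List A) {h h′ : A → ℕ} → (∀ x → h x ≡ h′ x) → ∑ xs h ≡ ∑ xs h′
∑-cong xs h≗h′ = cong sum (map-cong h≗h′ xs)

∑-zero : (xs : List A) {h : A → ℕ} → (∀ x → h x ≡ 0) → ∑ xs h ≡ 0
∑-zero [] h≗0 = refl
∑-zero (x ∷ xs) h≗0 = cong₂ _+_ (h≗0 x) (∑-zero xs h≗0)

∑-+ : (xs : List A) (h h′ : A → ℕ) → ∑ xs (λ x → h x + h′ x) ≡ ∑ xs h + ∑ xs h′
∑-+ [] h h′ = refl
∑-+ (x ∷ xs) h h′ =
  trans (cong (h x + h′ x +_) (∑-+ xs h h′)) (interchange (h x) (h′ x) (∑ xs h) (∑ xs h′))

∑-*ˡ : (xs : List A) (c : ℕ) (h : A → ℕ) → ∑ xs (λ x → c * h x) ≡ c * ∑ xs h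
∑-*ˡ [] c h = sym (*-zeroʳ c)
∑-*ˡ (x ∷ xs) c h =
  trans (cong (c * h x +_) (∑-*ˡ xs c h)) (sym (*-distribˡ-+ c (h x) (∑ xs h)))

∑-*ʳ : (xs : List A) (c : ℕ) (h : A → ℕ) → ∑ xs (λ x → h x * c) ≡ ∑ xs h * c
∑-*ʳ xs c h = trans (∑-cong xs (λ x → *-comm (h x) c)) (trans (∑-*ˡ xs c h) (*-comm c (∑ xs h)))

∑-concatMap : (f : A → List B) (xs : List A) (h : B → ℕ) →
  ∑ (concatMap f xs) h ≡ ∑ xs (λ x → ∑ (f x) h)
∑-concatMap f [] h = refl
∑-concatMap f (x ∷ xs) h = begin
  sum (map h (f x ++ concatMap f xs))          ≡⟨ cong sum (map-++ h (f x) (concatMap f xs)) ⟩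
  sum (map h (f x) ++ map h (concatMap f xs))  ≡⟨ sum-++ (map h (f x)) _ ⟩
  ∑ (f x) h + ∑ (concatMap f xs) h             ≡⟨ cong (∑ (f x) h +_) (∑-concatMap f xs h) ⟩
  ∑ (f x) h + ∑ xs (λ x → ∑ (f x) h)           ∎
  where open ≡-Reasoning

∑-map : (f : A → B) (xs : List A) (h : B → ℕ) → ∑ (map f xs) h ≡ ∑ xs (λ x → h (f x))
∑-map f xs h = cong sum (sym (map-∘ xs))

∑-swap : (xs : List A) (ys : List B) (k : A → B → ℕ) →
  ∑ xs (λ x → ∑ ys (k x)) ≡ ∑ ys (λ y → ∑ xs (λ x → k x y))
∑-swap [] ys k = sym (∑-zero ys (λ _ → refl))
∑-swap (x ∷ xs) ys k =
  trans (cong (∑ ys (k x) +_) (∑-swap xs ys k)) (sym (∑-+ ys (k x) (λ y → ∑ xs (λ x′ → k x′ y))))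

∑-product : (xs : List A) (ys : List B) (f : A → ℕ) (g : B → ℕ) →
  ∑ xs (λ x → ∑ ys (λ y → f x * g y)) ≡ ∑ xs f * ∑ ys g
∑-product xs ys f g = trans (∑-cong xs (λ x → ∑-*ˡ ys (f x) g)) (∑-*ʳ xs (∑ ys g) f)

length-filter≡∑𝟙 : {P : A → Set} (P? : ∀ x → Dec (P x)) (xs : List A) →
  length (filter P? xs) ≡ ∑ xs (λ x → 𝟙 (P? x))
length-filter≡∑𝟙 P? [] = refl
length-filter≡∑𝟙 P? (x ∷ xs) with P? x
... | yes _ = cong suc (length-filter≡∑𝟙 P? xs)
... | no _ = length-filter≡∑𝟙 P? xs

Enumerates : DecidableEquality A → List A → Set
Enumerates _≟_ xs = ∀ a → ∑ xs (λ x → 𝟙 (x ≟ a)) ≡ 1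

count-bijection : (_≟A_ : DecidableEquality A) (_≟B_ : DecidableEquality B)
  (xs : List A) (ys : List B) → Enumerates _≟A_ xs → Enumerates _≟B_ ys →
  {P : A → Set} {Q : B → Set} (P? : ∀ x → Dec (P x)) (Q? : ∀ y → Dec (Q y))
  (f : A → B) (g : B → A) → (∀ {x} → P x → Q (f x)) → (∀ {y} → Q y → P (g y)) →
  (∀ {x} → P x → g (f x) ≡ x) → (∀ {y} → Q y → f (g y) ≡ y) →
  ∑ xs (λ x → 𝟙 (P? x)) ≡ ∑ ys (λ y → 𝟙 (Q? y))
count-bijection _≟A_ _≟B_ xs ys xs-enum ys-enum {P} {Q} P? Q? f g P⇒Q Q⇒P g∘f f∘g = begin
  ∑ xs (λ x → 𝟙 (P? x))
    ≡⟨ ∑-cong xs (λ x → sym (trans (cong (𝟙 (P? x) *_) (ys-enum (f x))) (*-identityʳ _))) ⟩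
  ∑ xs (λ x → 𝟙 (P? x) * ∑ ys (λ y → 𝟙 (y ≟B f x)))
    ≡⟨ ∑-cong xs (λ x → sym (∑-*ˡ ys (𝟙 (P? x)) _)) ⟩
  ∑ xs (λ x → ∑ ys (λ y → 𝟙 (P? x) * 𝟙 (y ≟B f x)))
    ≡⟨ ∑-swap xs ys _ ⟩
  ∑ ys (λ y → ∑ xs (λ x → 𝟙 (P? x) * 𝟙 (y ≟B f x)))
    ≡⟨ ∑-cong ys fibre ⟩
  ∑ ys (λ y → 𝟙 (Q? y))
    ∎
  where
  open ≡-Reasoning
  -- Each y satisfying Q has exactly one preimage g y satisfying P; other y have none.
  fibre : ∀ y → ∑ xs (λ x → 𝟙 (P? x) * 𝟙 (y ≟B f x)) ≡ 𝟙 (Q? y)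
  fibre y with Q? y
  ... | yes Qy = trans (∑-cong xs (λ x → trans (sym (𝟙-× (P? x) (y ≟B f x)))
                  (𝟙-⇔ (λ (Px , y≡fx) → trans (sym (g∘f Px)) (cong g (sym y≡fx)))
                       (λ x≡gy → subst P (sym x≡gy) (Q⇒P Qy) , trans (sym (f∘g Qy)) (cong f (sym x≡gy)))
                       (P? x ×-dec (y ≟B f x)) (x ≟A g y))))
                 (xs-enum (g y))
  ... | no ¬Qy = ∑-zero xs (λ x → trans (sym (𝟙-× (P? x) (y ≟B f x)))
                  (𝟙-no (λ (Px , y≡fx) → ¬Qy (subst Q (sym y≡fx) (P⇒Q Px))) _))

pairsWith : (A → B → D) → List A → List B → List D
pairsWith k xs ys = concatMap (λ x → map (k x) ys) xs

∑-pairsWith : (k : A → B → D) (xs : List A) (ys : List B) (h : D → ℕ) →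
  ∑ (pairsWith k xs ys) h ≡ ∑ xs (λ x → ∑ ys (λ y → h (k x y)))
∑-pairsWith k xs ys h = trans (∑-concatMap _ xs h) (∑-cong xs (λ x → ∑-map (k x) ys h))

pairsWith-enumerates : (_≟A_ : DecidableEquality A) (_≟B_ : DecidableEquality B)
  (_≟D_ : DecidableEquality D) (k : A → B → D) →
  (∀ {x x′ y y′} → k x y ≡ k x′ y′ → x ≡ x′ × y ≡ y′) →
  (xs : List A) (ys : List B) → Enumerates _≟A_ xs → Enumerates _≟B_ ys →
  ∀ a b → ∑ (pairsWith k xs ys) (λ z → 𝟙 (z ≟D k a b)) ≡ 1
pairsWith-enumerates _≟A_ _≟B_ _≟D_ k k-injective xs ys xs-enum ys-enum a b = begin
  ∑ (pairsWith k xs ys) (λ z → 𝟙 (z ≟D k a b))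
    ≡⟨ ∑-pairsWith k xs ys _ ⟩
  ∑ xs (λ x → ∑ ys (λ y → 𝟙 (k x y ≟D k a b)))
    ≡⟨ ∑-cong xs (λ x → ∑-cong ys (λ y → trans
         (𝟙-⇔ k-injective (λ (x≡a , y≡b) → cong₂ k x≡a y≡b) (k x y ≟D k a b) ((x ≟A a) ×-dec (y ≟B b)))
         (𝟙-× (x ≟A a) (y ≟B b)))) ⟩
  ∑ xs (λ x → ∑ ys (λ y → 𝟙 (x ≟A a) * 𝟙 (y ≟B b)))
    ≡⟨ ∑-cong xs (λ x → trans (∑-*ˡ ys (𝟙 (x ≟A a)) _) (cong (𝟙 (x ≟A a) *_) (ys-enum b))) ⟩
  ∑ xs (λ x → 𝟙 (x ≟A a) * 1)
    ≡⟨ ∑-cong xs (λ x → *-identityʳ _) ⟩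
  ∑ xs (λ x → 𝟙 (x ≟A a))
    ≡⟨ xs-enum a ⟩
  1 ∎
  where open ≡-Reasoning

allBools-enumerates : Enumerates Boolₚ._≟_ allBools
allBools-enumerates true = refl
allBools-enumerates false = refl

allVecs-enumerates : (_≟_ : DecidableEquality A) (xs : List A) → Enumerates _≟_ xs →
  (n : ℕ) → Enumerates (Vecₚ.≡-dec _≟_) (allVecs xs n)
allVecs-enumerates _≟_ xs xs-enum zero [] = refl
allVecs-enumerates _≟_ xs xs-enum (suc n) (a ∷ v) =
  pairsWith-enumerates _≟_ (Vecₚ.≡-dec _≟_) (Vecₚ.≡-dec _≟_) _∷_ Vecₚ.∷-injective
    xs (allVecs xs n) xs-enum (allVecs-enumerates _≟_ xs xs-enum n) a v

pairs-enumerates : (_≟A_ : DecidableEquality A) (_≟B_ : DecidableEquality B)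
  (xs : List A) (ys : List B) → Enumerates _≟A_ xs → Enumerates _≟B_ ys →
  Enumerates (Productₚ.≡-dec _≟A_ _≟B_) (pairsWith _,_ xs ys)
pairs-enumerates _≟A_ _≟B_ xs ys xs-enum ys-enum (a , b) =
  pairsWith-enumerates _≟A_ _≟B_ (Productₚ.≡-dec _≟A_ _≟B_) _,_ Productₚ.,-injective
    xs ys xs-enum ys-enum a b

subsets : (n : ℕ) → List (Subset n)
subsets n = allVecs allBools n

partReps : (n : ℕ) → List (PartRep n)
partReps n = allVecs (subsets n) n

subsets-enumerate : (n : ℕ) → Enumerates (Vecₚ.≡-dec Boolₚ._≟_) (subsets n)
subsets-enumerate = allVecs-enumerates Boolₚ._≟_ allBools allBools-enumerates

partReps-enumerate : (n : ℕ) → Enumerates (Vecₚ.≡-dec (Vecₚ.≡-dec Boolₚ._≟_)) (partReps n)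
partReps-enumerate n = allVecs-enumerates _ (subsets n) (subsets-enumerate n) n

∈⇒lookup : ∀ {n} {x : Fin n} {p : Subset n} → x ∈ p → lookup p x ≡ true
∈⇒lookup = Vecₚ.[]=⇒lookup

lookup⇒∈ : ∀ {n} {x : Fin n} {p : Subset n} → lookup p x ≡ true → x ∈ p
lookup⇒∈ {x = x} {p} = Vecₚ.lookup⇒[]= x p

vec-ext : ∀ {n} {u v : Vec A n} → (∀ x → lookup u x ≡ lookup v x) → u ≡ v
vec-ext {u = u} {v} u≗v =
  trans (sym (Vecₚ.tabulate∘lookup u)) (trans (Vecₚ.tabulate-cong u≗v) (Vecₚ.tabulate∘lookup v))

RowAt : ∀ {n} → Bool → (Fin n → Subset n) → Fin n → Set
RowAt {n} true F x = x ∈ F x × ((y : Fin n) → y ∈ F x → F y ≡ F x)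
RowAt false F x = F x ≡ ⊥

rowAt? : ∀ {n} (b : Bool) (M : PartRep n) (x : Fin n) → Dec (RowAt b (lookup M) x)
rowAt? true M x = (x ∈? lookup M x) ×-dec
  Finₚ.all? (λ y → (y ∈? lookup M x) →-dec Vecₚ.≡-dec Boolₚ._≟_ (lookup M y) (lookup M x))
rowAt? false M x = Vecₚ.≡-dec Boolₚ._≟_ (lookup M x) ⊥

RowAt-cong : ∀ {n} (b : Bool) {F G : Fin n → Subset n} {x : Fin n} →
  (∀ z → F z ≡ G z) → RowAt b F x → RowAt b G x
RowAt-cong false {F} {G} {x} F≗G Fx≡⊥ = trans (sym (F≗G x)) Fx≡⊥
RowAt-cong true {F} {G} {x} F≗G (x∈ , closed) =
  subst (x ∈_) (F≗G x) x∈ ,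
  λ y y∈ → trans (sym (F≗G y)) (trans (closed y (subst (y ∈_) (sym (F≗G x)) y∈)) (F≗G x))

-- M represents a set partition of the subset S of Fin n: its rows on S are the
-- blocks of the partition, its rows off S are empty.  For S = ⊤ this is
-- IsSetPartition.
PartitionOn : ∀ {n} → Subset n → PartRep n → Set
PartitionOn S M = ∀ x → RowAt (lookup S x) (lookup M) x

partitionOn? : ∀ {n} (S : Subset n) (M : PartRep n) → Dec (PartitionOn S M)
partitionOn? S M = Finₚ.all? (λ x → rowAt? (lookup S x) M x)

member⇒inside : ∀ {n} {S : Subset n} {M : PartRep n} → PartitionOn S M →
  ∀ {x y} → y ∈ lookup M x → lookup S y ≡ true
member⇒inside {S = S} {M} M-part {x} {y} y∈Mx with lookup S x in Sx | lookup S y in Sy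
... | _ | true = refl
... | false | false = contradiction (subst (y ∈_) (row-at Sx) y∈Mx) ∉⊥
  where
  row-at : ∀ {b} → lookup S x ≡ b → RowAt b (lookup M) x
  row-at Sx = subst (λ b → RowAt b (lookup M) x) Sx (M-part x)
... | true | false = contradiction (subst (y ∈_) My≡⊥ y∈My) ∉⊥
  where
  -- y lies in its own row, as that row equals the row of x; but the row of y is empty.
  y∈My : y ∈ lookup M y
  y∈My = subst (y ∈_) (sym (proj₂ (subst (λ b → RowAt b (lookup M) x) Sx (M-part x)) y y∈Mx)) y∈Mx
  My≡⊥ : lookup M y ≡ ⊥
  My≡⊥ = subst (λ b → RowAt b (lookup M) y) Sy (M-part y)

partitionsOn : ∀ {n} → Subset n → ℕ
partitionsOn {n} S = ∑ (partReps n) (λ M → 𝟙 (partitionOn? S M))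

partitionsOn-full : ∀ {n} (S : Subset n) → (∀ x → lookup S x ≡ true) → partitionsOn S ≡ Bell n
partitionsOn-full {n} S full =
  trans (∑-cong (partReps n) (λ M → 𝟙-⇔ (to M) (from M) (partitionOn? S M) (isSetPartition? M)))
        (sym (length-filter≡∑𝟙 isSetPartition? (partReps n)))
  where
  to : ∀ M → PartitionOn S M → IsSetPartition M
  to M M-part x = subst (λ b → RowAt b (lookup M) x) (full x) (M-part x)
  from : ∀ M → IsSetPartition M → PartitionOn S M
  from M M-part x = subst (λ b → RowAt b (lookup M) x) (sym (full x)) (M-part x)

lookup-removeAt : ∀ {m} (v : Vec A (suc m)) (i : Fin (suc m)) (j : Fin m) →
  lookup (removeAt v i) j ≡ lookup v (punchIn i j)
lookup-removeAt (x ∷ v) zero j = refl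
lookup-removeAt (x ∷ y ∷ v) (suc i) zero = refl
lookup-removeAt (x ∷ y ∷ v) (suc i) (suc j) = lookup-removeAt (y ∷ v) i j

removeAt-⊥ : ∀ {m} (i : Fin (suc m)) → removeAt (⊥ {suc m}) i ≡ ⊥
removeAt-⊥ zero = refl
removeAt-⊥ {suc m} (suc i) = cong (false ∷_) (removeAt-⊥ i)

insertAt-⊥ : ∀ {m} (i : Fin (suc m)) → insertAt (⊥ {m}) i false ≡ ⊥
insertAt-⊥ zero = refl
insertAt-⊥ {suc m} (suc i) = cong (false ∷_) (insertAt-⊥ i)

∣removeAt∣ : ∀ {m} (S : Subset (suc m)) (i : Fin (suc m)) → lookup S i ≡ false →
  ∣ removeAt S i ∣ ≡ ∣ S ∣
∣removeAt∣ (false ∷ S) zero i∉S = refl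
∣removeAt∣ (true ∷ c ∷ S) (suc i) i∉S = cong suc (∣removeAt∣ (c ∷ S) i i∉S)
∣removeAt∣ (false ∷ c ∷ S) (suc i) i∉S = ∣removeAt∣ (c ∷ S) i i∉S

i-or-punchIn : ∀ {m} (i x : Fin (suc m)) → x ≡ i ⊎ ∃ λ x′ → punchIn i x′ ≡ x
i-or-punchIn i x with i Finₚ.≟ x
... | yes i≡x = inj₁ (sym i≡x)
... | no i≢x = inj₂ (punchOut i≢x , Finₚ.punchIn-punchOut i≢x)

-- A point i outside S can be deleted from the ground set: deleting row and
-- column i is a bijection from partitions of S onto partitions of S ∖ {i}
-- (as a subset of Fin m), with inverse inserting an empty row and column.
module Removal {m : ℕ} (S : Subset (suc m)) (i : Fin (suc m)) (i∉S : lookup S i ≡ false) where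

  S⁻ : Subset m
  S⁻ = removeAt S i

  shrink : PartRep (suc m) → PartRep m
  shrink M = removeAt (Vec.map (λ r → removeAt r i) M) i

  grow : PartRep m → PartRep (suc m)
  grow M = insertAt (Vec.map (λ r → insertAt r i false) M) i ⊥

  lookup-shrink : ∀ M x → lookup (shrink M) x ≡ removeAt (lookup M (punchIn i x)) i
  lookup-shrink M x =
    trans (lookup-removeAt (Vec.map (λ r → removeAt r i) M) i x) (Vecₚ.lookup-map (punchIn i x) _ M)

  lookup-grow-i : ∀ M → lookup (grow M) i ≡ ⊥
  lookup-grow-i M = Vecₚ.insertAt-lookup (Vec.map (λ r → insertAt r i false) M) i ⊥

  lookup-grow : ∀ M x → lookup (grow M) (punchIn i x) ≡ insertAt (lookup M x) i false
  lookup-grow M x =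
    trans (Vecₚ.insertAt-punchIn (Vec.map (λ r → insertAt r i false) M) i ⊥ x) (Vecₚ.lookup-map x _ M)

  ∈-shrink : ∀ M x y → y ∈ lookup (shrink M) x → punchIn i y ∈ lookup M (punchIn i x)
  ∈-shrink M x y y∈ = lookup⇒∈ (trans (sym (lookup-removeAt (lookup M (punchIn i x)) i y))
                                     (trans (cong (λ r → lookup r y) (sym (lookup-shrink M x))) (∈⇒lookup y∈)))

  ∈-grow : ∀ M x y → punchIn i y ∈ lookup (grow M) (punchIn i x) → y ∈ lookup M x
  ∈-grow M x y y∈ = lookup⇒∈ (trans (sym (Vecₚ.insertAt-punchIn (lookup M x) i false y))
                                    (trans (cong (λ r → lookup r (punchIn i y)) (sym (lookup-grow M x))) (∈⇒lookup y∈)))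

  shrink-row : ∀ (b : Bool) M x → RowAt b (lookup M) (punchIn i x) → RowAt b (lookup (shrink M)) x
  shrink-row false M x Mx≡⊥ = trans (lookup-shrink M x) (trans (cong (λ r → removeAt r i) Mx≡⊥) (removeAt-⊥ i))
  shrink-row true M x (x∈ , closed) =
    lookup⇒∈ (trans (cong (λ r → lookup r x) (lookup-shrink M x))
                    (trans (lookup-removeAt (lookup M (punchIn i x)) i x) (∈⇒lookup x∈))) ,
    λ y y∈ → trans (lookup-shrink M y)
               (trans (cong (λ r → removeAt r i) (closed (punchIn i y) (∈-shrink M x y y∈)))
                      (sym (lookup-shrink M x)))

  grow-row : ∀ (b : Bool) M x → RowAt b (lookup M) x → RowAt b (lookup (grow M)) (punchIn i x)
  grow-row false M x Mx≡⊥ = trans (lookup-grow M x) (trans (cong (λ r → insertAt r i false) Mx≡⊥) (insertAt-⊥ i))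
  grow-row true M x (x∈ , closed) =
    lookup⇒∈ (trans (cong (λ r → lookup r (punchIn i x)) (lookup-grow M x))
                    (trans (Vecₚ.insertAt-punchIn (lookup M x) i false x) (∈⇒lookup x∈))) ,
    λ y y∈ → closed′ y (i-or-punchIn i y) y∈
    where
    closed′ : ∀ y → y ≡ i ⊎ ∃ (λ y′ → punchIn i y′ ≡ y) → y ∈ lookup (grow M) (punchIn i x) →
      lookup (grow M) y ≡ lookup (grow M) (punchIn i x)
    closed′ y (inj₁ refl) i∈ = contradiction
      (trans (sym (∈⇒lookup i∈)) (trans (cong (λ r → lookup r i) (lookup-grow M x))
                                        (Vecₚ.insertAt-lookup (lookup M x) i false)))
      λ ()
    closed′ y (inj₂ (y′ , refl)) y∈ =
      trans (lookup-grow M y′) (trans (cong (λ r → insertAt r i false) (closed y′ (∈-grow M x y′ y∈)))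
                                      (sym (lookup-grow M x)))

  shrink-partition : ∀ {M} → PartitionOn S M → PartitionOn S⁻ (shrink M)
  shrink-partition {M} M-part x = shrink-row (lookup S⁻ x) M x
    (subst (λ b → RowAt b (lookup M) (punchIn i x)) (sym (lookup-removeAt S i x)) (M-part (punchIn i x)))

  grow-partition : ∀ {M} → PartitionOn S⁻ M → PartitionOn S (grow M)
  grow-partition {M} M-part x with i-or-punchIn i x
  ... | inj₁ refl = subst (λ b → RowAt b (lookup (grow M)) i) (sym i∉S) (lookup-grow-i M)
  ... | inj₂ (x′ , refl) = subst (λ b → RowAt b (lookup (grow M)) (punchIn i x′))
    (lookup-removeAt S i x′) (grow-row (lookup S⁻ x′) M x′ (M-part x′))

  shrink∘grow : ∀ M → shrink (grow M) ≡ M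
  shrink∘grow M = vec-ext λ x → trans (lookup-shrink (grow M) x)
    (trans (cong (λ r → removeAt r i) (lookup-grow M x)) (Vecₚ.removeAt-insertAt (lookup M x) i false))

  -- In a partition of S, row i and column i are empty since i ∉ S.
  grow∘shrink : ∀ {M} → PartitionOn S M → grow (shrink M) ≡ M
  grow∘shrink {M} M-part = vec-ext row
    where
    column-i : ∀ x → lookup (lookup M x) i ≡ false
    column-i x with lookup (lookup M x) i in i∈Mx
    ... | false = refl
    ... | true = contradiction (trans (sym (member⇒inside {S = S} {M} M-part {x} (lookup⇒∈ i∈Mx))) i∉S) λ ()
    row : ∀ x → lookup (grow (shrink M)) x ≡ lookup M x
    row x with i-or-punchIn i x
    ... | inj₁ refl = trans (lookup-grow-i (shrink M)) (sym (subst (λ b → RowAt b (lookup M) i) i∉S (M-part i)))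
    ... | inj₂ (x′ , refl) = begin
      lookup (grow (shrink M)) (punchIn i x′)              ≡⟨ lookup-grow (shrink M) x′ ⟩
      insertAt (lookup (shrink M) x′) i false              ≡⟨ cong (λ r → insertAt r i false) (lookup-shrink M x′) ⟩
      insertAt (removeAt (lookup M (punchIn i x′)) i) i false
        ≡⟨ cong (insertAt _ i) (sym (column-i (punchIn i x′))) ⟩
      insertAt (removeAt (lookup M (punchIn i x′)) i) i (lookup (lookup M (punchIn i x′)) i)
        ≡⟨ Vecₚ.insertAt-removeAt (lookup M (punchIn i x′)) i ⟩
      lookup M (punchIn i x′)                              ∎
      where open ≡-Reasoning

  partitionsOn-removeAt : partitionsOn S ≡ partitionsOn S⁻
  partitionsOn-removeAt = count-bijection _ _ (partReps (suc m)) (partReps m)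
    (partReps-enumerate (suc m)) (partReps-enumerate m) (partitionOn? S) (partitionOn? S⁻)
    shrink grow (λ {M} → shrink-partition {M}) (λ {M} → grow-partition {M})
    (λ {M} → grow∘shrink {M}) (λ {M} _ → shrink∘grow M)

partitionsOn≡Bell : ∀ n (S : Subset n) → partitionsOn S ≡ Bell ∣ S ∣
partitionsOn≡Bell zero [] = partitionsOn-full [] λ ()
partitionsOn≡Bell (suc m) S with Finₚ.any? (λ x → lookup S x Boolₚ.≟ false)
... | yes (i , i∉S) = begin
  partitionsOn S                   ≡⟨ Removal.partitionsOn-removeAt S i i∉S ⟩
  partitionsOn (removeAt S i)      ≡⟨ partitionsOn≡Bell m (removeAt S i) ⟩
  Bell ∣ removeAt S i ∣            ≡⟨ cong Bell (∣removeAt∣ S i i∉S) ⟩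
  Bell ∣ S ∣                       ∎
  where open ≡-Reasoning
... | no ¬∃i∉S = begin
  partitionsOn S     ≡⟨ partitionsOn-full S full ⟩
  Bell (suc m)       ≡⟨ cong Bell (sym (trans (cong ∣_∣ S≡⊤) (∣⊤∣≡n (suc m)))) ⟩
  Bell ∣ S ∣         ∎
  where
  open ≡-Reasoning
  full : ∀ x → lookup S x ≡ true
  full x with lookup S x in Sx
  ... | true = refl
  ... | false = contradiction (x , Sx) ¬∃i∉S
  S≡⊤ : S ≡ ⊤
  S≡⊤ = vec-ext λ x → trans (full x) (sym (Vecₚ.lookup-replicate x true))

∑< : ℕ → (ℕ → ℕ) → ℕ
∑< zero F = 0
∑< (suc m) F = F 0 + ∑< m (λ j → F (suc j))

∑<-cong : ∀ m {F G : ℕ → ℕ} → (∀ j → F j ≡ G j) → ∑< m F ≡ ∑< m G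
∑<-cong zero F≗G = refl
∑<-cong (suc m) F≗G = cong₂ _+_ (F≗G 0) (∑<-cong m (λ j → F≗G (suc j)))

∑<-+ : ∀ m (F G : ℕ → ℕ) → ∑< m (λ j → F j + G j) ≡ ∑< m F + ∑< m G
∑<-+ zero F G = refl
∑<-+ (suc m) F G =
  trans (cong (F 0 + G 0 +_) (∑<-+ m _ _)) (interchange (F 0) (G 0) (∑< m _) (∑< m _))

∑<-suc : ∀ m (F : ℕ → ℕ) → ∑< (suc m) F ≡ ∑< m F + F m
∑<-suc zero F = +-comm (F 0) 0
∑<-suc (suc m) F = trans (cong (F 0 +_) (∑<-suc m (λ j → F (suc j)))) (sym (+-assoc (F 0) _ _))

∑-applyUpTo : ∀ m (g : ℕ → ℕ) (F : ℕ → ℕ) → ∑ (applyUpTo g m) F ≡ ∑< m (λ j → F (g j))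
∑-applyUpTo zero g F = refl
∑-applyUpTo (suc m) g F = cong (F (g 0) +_) (∑-applyUpTo m (λ j → g (suc j)) F)

∑<-pascal : ∀ m (f : ℕ → ℕ) →
  ∑< (suc (suc m)) (λ j → (suc m C j) * f j) ≡
  ∑< (suc m) (λ j → (m C j) * f (suc j)) + ∑< (suc m) (λ j → (m C j) * f j)
∑<-pascal m f = begin
  1 * f 0 + ∑< (suc m) (λ j → (suc m C suc j) * f (suc j))
    ≡⟨ cong (1 * f 0 +_) (∑<-cong (suc m) (λ j → trans
         (cong (_* f (suc j)) (sym (nCk+nC[k+1]≡[n+1]C[k+1] m j))) (*-distribʳ-+ (f (suc j)) (m C j) _))) ⟩
  1 * f 0 + ∑< (suc m) (λ j → (m C j) * f (suc j) + (m C suc j) * f (suc j))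
    ≡⟨ cong (1 * f 0 +_) (∑<-+ (suc m) (λ j → (m C j) * f (suc j)) (λ j → (m C suc j) * f (suc j))) ⟩
  1 * f 0 + (shifted + ∑< (suc m) (λ j → (m C suc j) * f (suc j)))
    ≡⟨ cong (λ z → 1 * f 0 + (shifted + z)) (∑<-suc m _) ⟩
  1 * f 0 + (shifted + (rest + (m C suc m) * f (suc m)))
    ≡⟨ cong (λ c → 1 * f 0 + (shifted + (rest + c * f (suc m)))) (k>n⇒nCk≡0 (n<1+n m)) ⟩
  1 * f 0 + (shifted + (rest + 0))
    ≡⟨ cong (λ z → 1 * f 0 + (shifted + z)) (+-identityʳ rest) ⟩
  1 * f 0 + (shifted + rest)
    ≡⟨ x∙yz≈y∙xz (1 * f 0) shifted rest ⟩
  shifted + (1 * f 0 + rest)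
    ∎
  where
  open ≡-Reasoning
  shifted rest : ℕ
  shifted = ∑< (suc m) (λ j → (m C j) * f (suc j))
  rest = ∑< m (λ j → (m C suc j) * f (suc j))

∑-subsets-suc : ∀ n (F : Subset (suc n) → ℕ) →
  ∑ (subsets (suc n)) F ≡ ∑ (subsets n) (λ L → F (true ∷ L)) + ∑ (subsets n) (λ L → F (false ∷ L))
∑-subsets-suc n F =
  trans (∑-pairsWith _∷_ allBools (subsets n) F) (cong (∑ (subsets n) (λ L → F (true ∷ L)) +_) (+-identityʳ _))

𝟙-in⊆in : ∀ {n} (K L : Subset n) → 𝟙 ((true ∷ K) ⊆? (true ∷ L)) ≡ 𝟙 (K ⊆? L)
𝟙-in⊆in K L = 𝟙-⇔ (Equivalence.from in⊆in-⇔) (Equivalence.to in⊆in-⇔) _ _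

𝟙-out⊆ : ∀ {n} (b : Bool) (K L : Subset n) → 𝟙 ((false ∷ K) ⊆? (b ∷ L)) ≡ 𝟙 (K ⊆? L)
𝟙-out⊆ b K L = 𝟙-⇔ (Equivalence.from out⊆-⇔) (Equivalence.to out⊆-⇔) _ _

𝟙-in⊆out : ∀ {n} (K L : Subset n) → 𝟙 ((true ∷ K) ⊆? (false ∷ L)) ≡ 0
𝟙-in⊆out K L = 𝟙-no (λ K⊆L → case K⊆L here of λ ()) ((true ∷ K) ⊆? (false ∷ L))

-- By induction on n: a first point in K must lie in L; a first point outside
-- K may or may not, and the two resulting sums recombine by Pascal's rule.
∑-supersets : ∀ n (K : Subset n) (h : ℕ → ℕ) →
  ∑ (subsets n) (λ L → 𝟙 (K ⊆? L) * h ∣ L ∣) ≡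
  ∑< (suc (n ∸ ∣ K ∣)) (λ j → ((n ∸ ∣ K ∣) C j) * h (∣ K ∣ + j))
∑-supersets zero [] h = refl
∑-supersets (suc n) (true ∷ K) h = begin
  ∑ (subsets (suc n)) (λ L → 𝟙 ((true ∷ K) ⊆? L) * h ∣ L ∣)
    ≡⟨ ∑-subsets-suc n _ ⟩
  ∑ (subsets n) (λ L → 𝟙 ((true ∷ K) ⊆? (true ∷ L)) * h (suc ∣ L ∣)) +
  ∑ (subsets n) (λ L → 𝟙 ((true ∷ K) ⊆? (false ∷ L)) * h ∣ L ∣)
    ≡⟨ cong₂ _+_ (∑-cong (subsets n) (λ L → cong (_* h (suc ∣ L ∣)) (𝟙-in⊆in K L)))
                 (∑-zero (subsets n) (λ L → cong (_* h ∣ L ∣) (𝟙-in⊆out K L))) ⟩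
  ∑ (subsets n) (λ L → 𝟙 (K ⊆? L) * h (suc ∣ L ∣)) + 0
    ≡⟨ +-identityʳ _ ⟩
  ∑ (subsets n) (λ L → 𝟙 (K ⊆? L) * h (suc ∣ L ∣))
    ≡⟨ ∑-supersets n K (λ l → h (suc l)) ⟩
  ∑< (suc (n ∸ ∣ K ∣)) (λ j → ((n ∸ ∣ K ∣) C j) * h (suc (∣ K ∣ + j)))
    ∎
  where open ≡-Reasoning
∑-supersets (suc n) (false ∷ K) h = begin
  ∑ (subsets (suc n)) (λ L → 𝟙 ((false ∷ K) ⊆? L) * h ∣ L ∣)
    ≡⟨ ∑-subsets-suc n _ ⟩
  ∑ (subsets n) (λ L → 𝟙 ((false ∷ K) ⊆? (true ∷ L)) * h (suc ∣ L ∣)) +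
  ∑ (subsets n) (λ L → 𝟙 ((false ∷ K) ⊆? (false ∷ L)) * h ∣ L ∣)
    ≡⟨ cong₂ _+_ (∑-cong (subsets n) (λ L → cong (_* h (suc ∣ L ∣)) (𝟙-out⊆ true K L)))
                 (∑-cong (subsets n) (λ L → cong (_* h ∣ L ∣) (𝟙-out⊆ false K L))) ⟩
  ∑ (subsets n) (λ L → 𝟙 (K ⊆? L) * h (suc ∣ L ∣)) + ∑ (subsets n) (λ L → 𝟙 (K ⊆? L) * h ∣ L ∣)
    ≡⟨ cong₂ _+_ (∑-supersets n K (λ l → h (suc l))) (∑-supersets n K h) ⟩
  ∑< (suc d) (λ j → (d C j) * h (suc (k + j))) + ∑< (suc d) (λ j → (d C j) * h (k + j))
    ≡⟨ cong (_+ ∑< (suc d) (λ j → (d C j) * h (k + j)))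
            (∑<-cong (suc d) (λ j → cong (λ l → (d C j) * h l) (sym (+-suc k j)))) ⟩
  ∑< (suc d) (λ j → (d C j) * h (k + suc j)) + ∑< (suc d) (λ j → (d C j) * h (k + j))
    ≡⟨ sym (∑<-pascal d (λ j → h (k + j))) ⟩
  ∑< (suc (suc d)) (λ j → (suc d C j) * h (k + j))
    ≡⟨ cong (λ d′ → ∑< (suc d′) (λ j → (d′ C j) * h (k + j))) (sym (+-∸-assoc 1 (∣p∣≤n K))) ⟩
  ∑< (suc (suc n ∸ k)) (λ j → ((suc n ∸ k) C j) * h (k + j))
    ∎
  where
  open ≡-Reasoning
  k d : ℕ
  k = ∣ K ∣
  d = n ∸ ∣ K ∣

∈⇒1≤∣∣ : ∀ {n} {x : Fin n} {p : Subset n} → x ∈ p → 1 ≤ ∣ p ∣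
∈⇒1≤∣∣ x∈p = ≤-trans (s≤s z≤n) (x∈p⇒∣p-x∣<∣p∣ x∈p)

1≤∣∣⇒nonempty : ∀ {n} (p : Subset n) → 1 ≤ ∣ p ∣ → Nonempty p
1≤∣∣⇒nonempty {n} p 1≤∣p∣ with nonempty? p
... | yes p-nonempty = p-nonempty
... | no p-empty = contradiction (trans (cong ∣_∣ (Empty-unique p-empty)) (∣⊥∣≡0 n)) (≢-sym (<⇒≢ 1≤∣p∣))

T⇒≡true : ∀ {a} → T a → a ≡ true
T⇒≡true = Equivalence.to Boolₚ.T-≡

≡true⇒T : ∀ {a} → a ≡ true → T a
≡true⇒T = Equivalence.from Boolₚ.T-≡

agree : Bool → Bool → Bool
agree true a = a
agree false a = not a

agree-self : ∀ a → agree a a ≡ true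
agree-self true = refl
agree-self false = refl

agree⇒≡ : ∀ b a → agree b a ≡ true → a ≡ b
agree⇒≡ true true _ = refl
agree⇒≡ false false _ = refl

side : ∀ {n} → Bool → Subset n → Subset n
side true L = L
side false L = ∁ L

lookup-side : ∀ {n} b (L : Subset n) x → lookup (side b L) x ≡ agree b (lookup L x)
lookup-side true L x = refl
lookup-side false L x = Vecₚ.lookup-map x not L

LabelledRow : ∀ {n} → (Fin n → Block n) → Fin n → Set
LabelledRow {n} F x = x ∈ proj₁ (F x) × ((y : Fin n) → y ∈ proj₁ (F x) → F y ≡ F x)

LabelledRow-cong : ∀ {n} {F G : Fin n → Block n} {x : Fin n} →
  (∀ z → F z ≡ G z) → LabelledRow F x → LabelledRow G x
LabelledRow-cong {F = F} {G} {x} F≗G (x∈ , closed) =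
  subst (λ c → x ∈ proj₁ c) (F≗G x) x∈ ,
  λ y y∈ → trans (sym (F≗G y)) (trans (closed y (subst (λ c → y ∈ proj₁ c) (sym (F≗G x)) y∈)) (F≗G x))

Counted : ∀ {n} → Subset n → LPRep n → Set
Counted K π = IsLabelledSetPartition π × (π₀ K ≤ₗ π × HasLabelledBlock π)

counted? : ∀ {n} (K : Subset n) (π : LPRep n) → Dec (Counted K π)
counted? K π = isLabelledSetPartition? π ×-dec (π₀ K ≤ₗ? π) ×-dec hasLabelledBlock? π

-- A triple (L , M₁ , M₂) describes a labelled partition by the set L of points
-- in labelled blocks, a partition M₁ of L (the labelled blocks) and a
-- partition M₂ of ∁ L (the unlabelled blocks).
Triple : ℕ → Set
Triple n = Subset n × (PartRep n × PartRep n)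

component : ∀ {n} → Bool → Triple n → PartRep n
component true (_ , M₁ , _) = M₁
component false (_ , _ , M₂) = M₂

Admissible : ∀ {n} → Subset n → Triple n → Set
Admissible K (L , M₁ , M₂) = K ⊆ L × (1 ≤ ∣ L ∣ × (PartitionOn L M₁ × PartitionOn (∁ L) M₂))

admissible? : ∀ {n} (K : Subset n) (t : Triple n) → Dec (Admissible K t)
admissible? K (L , M₁ , M₂) =
  (K ⊆? L) ×-dec (1 ≤? ∣ L ∣) ×-dec (partitionOn? L M₁ ×-dec partitionOn? (∁ L) M₂)

component-partition : ∀ {n} {K : Subset n} {L M₁ M₂} → Admissible K (L , M₁ , M₂) →
  ∀ b → PartitionOn (side b L) (component b (L , M₁ , M₂))
component-partition (_ , _ , M₁-part , _) true = M₁-part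
component-partition (_ , _ , _ , M₂-part) false = M₂-part

restrict : ∀ {n} → Bool → Block n → Subset n
restrict b (B , a) = if agree b a then B else ⊥

restrict-same : ∀ {n} b {B : Subset n} {a} → agree b a ≡ true → restrict b (B , a) ≡ B
restrict-same b ab rewrite ab = refl

restrict-other : ∀ {n} b {B : Subset n} {a} → agree b a ≡ false → restrict b (B , a) ≡ ⊥
restrict-other b ab rewrite ab = refl

labels : ∀ {n} → LPRep n → Subset n
labels π = tabulate (λ x → proj₂ (lookup π x))

part : ∀ {n} → Bool → LPRep n → PartRep n
part b π = tabulate (λ x → restrict b (lookup π x))

toTriple : ∀ {n} → LPRep n → Triple n
toTriple π = labels π , part true π , part false π

component-toTriple : ∀ {n} b (π : LPRep n) → component b (toTriple π) ≡ part b π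
component-toTriple true π = refl
component-toTriple false π = refl

blockAt : ∀ {n} → Triple n → Fin n → Block n
blockAt t@(L , _) x = lookup (component (lookup L x) t) x , lookup L x

fromTriple : ∀ {n} → Triple n → LPRep n
fromTriple t = tabulate (blockAt t)

blockAt-label : ∀ {n} (t : Triple n) x {b} → lookup (proj₁ t) x ≡ b →
  blockAt t x ≡ (lookup (component b t) x , b)
blockAt-label t x refl = refl

part-row : ∀ {n} (π : LPRep n) → IsLabelledSetPartition π → ∀ b x →
  RowAt (agree b (proj₂ (lookup π x))) (λ z → restrict b (lookup π z)) x
part-row π π-part b x with lookup π x in πx | π-part x
... | B , a | x∈B , closed with agree b a in ab
...   | true = subst (x ∈_) (sym row≡B) x∈B ,
               λ y y∈ → trans (cong (restrict b) (closed y (subst (y ∈_) row≡B y∈))) (sym (cong (restrict b) πx))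
  where
  row≡B : restrict b (lookup π x) ≡ B
  row≡B = trans (cong (restrict b) πx) (restrict-same b ab)
...   | false = trans (cong (restrict b) πx) (restrict-other b ab)

part-partition : ∀ {n} (π : LPRep n) → IsLabelledSetPartition π →
  ∀ b → PartitionOn (side b (labels π)) (part b π)
part-partition π π-part b x =
  subst (λ c → RowAt c (lookup (part b π)) x) (sym label-at-x)
    (RowAt-cong _ (λ z → sym (Vecₚ.lookup∘tabulate _ z)) (part-row π π-part b x))
  where
  label-at-x : lookup (side b (labels π)) x ≡ agree b (proj₂ (lookup π x))
  label-at-x = trans (lookup-side b (labels π) x) (cong (agree b) (Vecₚ.lookup∘tabulate _ x))

K⊆labels : ∀ {n} (K : Subset n) (π : LPRep n) → Counted K π → K ⊆ labels π
K⊆labels K π (π-part , π₀≤π , _) {x} x∈K with π₀≤π x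
... | y , ⁅x⁆⊆πy , label⇒ =
  lookup⇒∈ (trans (Vecₚ.lookup∘tabulate _ x) (trans (cong proj₂ πx≡πy) (T⇒≡true (label⇒ x-labelled))))
  where
  π₀x : lookup (π₀ K) x ≡ (⁅ x ⁆ , lookup K x)
  π₀x = Vecₚ.lookup∘tabulate _ x
  πx≡πy : lookup π x ≡ lookup π y
  πx≡πy = proj₂ (π-part y) x (⁅x⁆⊆πy (subst (λ c → x ∈ proj₁ c) (sym π₀x) (x∈⁅x⁆ x)))
  x-labelled : T (proj₂ (lookup (π₀ K) x))
  x-labelled = subst (λ c → T (proj₂ c)) (sym π₀x) (≡true⇒T (∈⇒lookup x∈K))

toTriple-admissible : ∀ {n} (K : Subset n) (π : LPRep n) → Counted K π → Admissible K (toTriple π)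
toTriple-admissible K π counted@(π-part , _ , (x , x-labelled)) =
  K⊆labels K π counted ,
  ∈⇒1≤∣∣ {p = labels π} (lookup⇒∈ (trans (Vecₚ.lookup∘tabulate _ x) (T⇒≡true x-labelled))) ,
  part-partition π π-part true ,
  part-partition π π-part false

blockAt-row : ∀ {n} {K : Subset n} (t : Triple n) → Admissible K t → ∀ x → LabelledRow (blockAt t) x
blockAt-row t@(L , _) adm x = row (lookup L x) refl
  where
  row : ∀ b → lookup L x ≡ b → LabelledRow (blockAt t) x
  row b Lx = subst (λ c → x ∈ proj₁ c) (sym x-block) x∈ ,
    λ y y∈ → let y∈′ = subst (λ c → y ∈ proj₁ c) x-block y∈ in
      trans (blockAt-label t y (same-label y∈′)) (trans (cong (_, b) (closed y y∈′)) (sym x-block))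
    where
    M-part : PartitionOn (side b L) (component b t)
    M-part = component-partition adm b
    x-block : blockAt t x ≡ (lookup (component b t) x , b)
    x-block = blockAt-label t x Lx
    inside : RowAt true (lookup (component b t)) x
    inside = subst (λ c → RowAt c (lookup (component b t)) x)
      (trans (lookup-side b L x) (trans (cong (agree b) Lx) (agree-self b))) (M-part x)
    x∈ : x ∈ lookup (component b t) x
    x∈ = proj₁ inside
    closed : ∀ y → y ∈ lookup (component b t) x → lookup (component b t) y ≡ lookup (component b t) x
    closed = proj₂ inside
    same-label : ∀ {y} → y ∈ lookup (component b t) x → lookup L y ≡ b
    same-label {y} y∈ =
      agree⇒≡ b _ (trans (sym (lookup-side b L y)) (member⇒inside {S = side b L} {component b t} M-part {x} y∈))

fromTriple-counted : ∀ {n} (K : Subset n) (t : Triple n) → Admissible K t → Counted K (fromTriple t)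
fromTriple-counted K t@(L , _) adm@(K⊆L , 1≤∣L∣ , _) = π-part , π₀≤π , labelled-block
  where
  lookup-fromTriple : ∀ z → blockAt t z ≡ lookup (fromTriple t) z
  lookup-fromTriple z = sym (Vecₚ.lookup∘tabulate (blockAt t) z)
  π-part : IsLabelledSetPartition (fromTriple t)
  π-part x = LabelledRow-cong lookup-fromTriple (blockAt-row t adm x)
  π₀≤π : π₀ K ≤ₗ fromTriple t
  π₀≤π x = x , ⁅x⁆⊆ , label⇒
    where
    π₀x : lookup (π₀ K) x ≡ (⁅ x ⁆ , lookup K x)
    π₀x = Vecₚ.lookup∘tabulate _ x
    ⁅x⁆⊆ : proj₁ (lookup (π₀ K) x) ⊆ proj₁ (lookup (fromTriple t) x)
    ⁅x⁆⊆ {z} z∈ = subst (λ w → w ∈ proj₁ (lookup (fromTriple t) x))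
                         (sym (x∈⁅y⁆⇒x≡y x (subst (λ c → z ∈ proj₁ c) π₀x z∈))) (proj₁ (π-part x))
    -- A point of K lies in L, so its block is labelled.
    label⇒ : T (proj₂ (lookup (π₀ K) x)) → T (proj₂ (lookup (fromTriple t) x))
    label⇒ x∈K = subst (λ c → T (proj₂ c)) (lookup-fromTriple x)
      (≡true⇒T (∈⇒lookup (K⊆L (lookup⇒∈ (T⇒≡true (subst (λ c → T (proj₂ c)) π₀x x∈K))))))
  labelled-block : HasLabelledBlock (fromTriple t)
  labelled-block = let (x , x∈L) = 1≤∣∣⇒nonempty L 1≤∣L∣ in
    x , subst (λ c → T (proj₂ c)) (lookup-fromTriple x) (≡true⇒T (∈⇒lookup x∈L))

fromTriple∘toTriple : ∀ {n} (π : LPRep n) → fromTriple (toTriple π) ≡ π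
fromTriple∘toTriple π = vec-ext λ x → let a = proj₂ (lookup π x) in begin
  lookup (fromTriple (toTriple π)) x           ≡⟨ Vecₚ.lookup∘tabulate _ x ⟩
  blockAt (toTriple π) x                       ≡⟨ blockAt-label (toTriple π) x (Vecₚ.lookup∘tabulate _ x) ⟩
  (lookup (component a (toTriple π)) x , a)    ≡⟨ cong (λ M → lookup M x , a) (component-toTriple a π) ⟩
  (lookup (part a π) x , a)                    ≡⟨ cong (_, a) (Vecₚ.lookup∘tabulate _ x) ⟩
  (restrict a (lookup π x) , a)                ≡⟨ restored (lookup π x) ⟩
  lookup π x                                   ∎
  where
  open ≡-Reasoning
  restored : ∀ c → (restrict (proj₂ c) c , proj₂ c) ≡ c
  restored (B , a) = cong (_, a) (restrict-same a (agree-self a))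

-- Off its own label, a point's row in the other component is empty.
restrict-blockAt : ∀ {n} {K : Subset n} (t : Triple n) → Admissible K t →
  ∀ b x → restrict b (blockAt t x) ≡ lookup (component b t) x
restrict-blockAt t@(L , _) adm b x with agree b (lookup L x) in ab
... | true = cong (λ b′ → lookup (component b′ t) x) (agree⇒≡ b _ ab)
... | false = sym (subst (λ c → RowAt c (lookup (component b t)) x)
                         (trans (lookup-side b L x) ab) (component-partition adm b x))

toTriple∘fromTriple : ∀ {n} {K : Subset n} (t : Triple n) → Admissible K t → toTriple (fromTriple t) ≡ t
toTriple∘fromTriple t@(L , M₁ , M₂) adm =
  cong₂ _,_ (vec-ext same-labels) (cong₂ _,_ (vec-ext (same-parts true)) (vec-ext (same-parts false)))
  where
  same-labels : ∀ x → lookup (labels (fromTriple t)) x ≡ lookup L x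
  same-labels x = trans (Vecₚ.lookup∘tabulate _ x) (cong proj₂ (Vecₚ.lookup∘tabulate (blockAt t) x))
  same-parts : ∀ b x → lookup (part b (fromTriple t)) x ≡ lookup (component b t) x
  same-parts b x = trans (Vecₚ.lookup∘tabulate _ x)
    (trans (cong (restrict b) (Vecₚ.lookup∘tabulate (blockAt t) x)) (restrict-blockAt t adm b x))

labelledReps : (n : ℕ) → List (LPRep n)
labelledReps n = allVecs (pairsWith _,_ (subsets n) allBools) n

triples : (n : ℕ) → List (Triple n)
triples n = pairsWith _,_ (subsets n) (pairsWith _,_ (partReps n) (partReps n))

P≡admissibleTriples : ∀ {n} (K : Subset n) → P K ≡ ∑ (triples n) (λ t → 𝟙 (admissible? K t))
P≡admissibleTriples {n} K = trans (length-filter≡∑𝟙 (counted? K) (labelledReps n))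
  (count-bijection _ _ (labelledReps n) (triples n)
    (allVecs-enumerates _ _ (pairs-enumerates _ Boolₚ._≟_ (subsets n) allBools (subsets-enumerate n) allBools-enumerates) n)
    (pairs-enumerates _ _ (subsets n) _ (subsets-enumerate n)
      (pairs-enumerates _ _ (partReps n) (partReps n) (partReps-enumerate n) (partReps-enumerate n)))
    (counted? K) (admissible? K) toTriple fromTriple
    (λ {π} → toTriple-admissible K π) (λ {t} → fromTriple-counted K t)
    (λ {π} _ → fromTriple∘toTriple π) (λ {t} → toTriple∘fromTriple t))

-- The number of labelled partitions counted by P whose labelled points form a
-- set of size l: B(l)·B(n − l) if l ≥ 1, and 0 if l = 0.
weight : ℕ → ℕ → ℕ
weight n l = 𝟙 (1 ≤? l) * (Bell l * Bell (n ∸ l))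

admissibleTriples-over : ∀ {n} (K L : Subset n) →
  ∑ (pairsWith _,_ (partReps n) (partReps n)) (λ p → 𝟙 (admissible? K (L , p))) ≡ 𝟙 (K ⊆? L) * weight n ∣ L ∣
admissibleTriples-over {n} K L = begin
  ∑ (pairsWith _,_ (partReps n) (partReps n)) (λ p → 𝟙 (admissible? K (L , p)))
    ≡⟨ ∑-pairsWith _,_ (partReps n) (partReps n) _ ⟩
  ∑ (partReps n) (λ M₁ → ∑ (partReps n) (λ M₂ → 𝟙 (admissible? K (L , M₁ , M₂))))
    ≡⟨ ∑-cong (partReps n) (λ M₁ → ∑-cong (partReps n) (λ M₂ → factor M₁ M₂)) ⟩
  ∑ (partReps n) (λ M₁ → ∑ (partReps n) (λ M₂ → ab * 𝟙 (partitionOn? L M₁) * 𝟙 (partitionOn? (∁ L) M₂)))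
    ≡⟨ ∑-product (partReps n) (partReps n) _ _ ⟩
  ∑ (partReps n) (λ M₁ → ab * 𝟙 (partitionOn? L M₁)) * partitionsOn (∁ L)
    ≡⟨ cong (_* partitionsOn (∁ L)) (∑-*ˡ (partReps n) ab _) ⟩
  ab * partitionsOn L * partitionsOn (∁ L)
    ≡⟨ cong₂ (λ u v → ab * u * v) (partitionsOn≡Bell n L)
             (trans (partitionsOn≡Bell n (∁ L)) (cong Bell (∣∁p∣≡n∸∣p∣ L))) ⟩
  𝟙 (K ⊆? L) * 𝟙 (1 ≤? ∣ L ∣) * Bell ∣ L ∣ * Bell (n ∸ ∣ L ∣)
    ≡⟨ trans (*-assoc ab _ _) (*-assoc (𝟙 (K ⊆? L)) _ _) ⟩
  𝟙 (K ⊆? L) * weight n ∣ L ∣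
    ∎
  where
  open ≡-Reasoning
  ab : ℕ
  ab = 𝟙 (K ⊆? L) * 𝟙 (1 ≤? ∣ L ∣)
  factor : ∀ M₁ M₂ → 𝟙 (admissible? K (L , M₁ , M₂)) ≡ ab * 𝟙 (partitionOn? L M₁) * 𝟙 (partitionOn? (∁ L) M₂)
  factor M₁ M₂ = begin
    𝟙 (admissible? K (L , M₁ , M₂))
      ≡⟨ 𝟙-× (K ⊆? L) _ ⟩
    𝟙 (K ⊆? L) * 𝟙 ((1 ≤? ∣ L ∣) ×-dec (partitionOn? L M₁ ×-dec partitionOn? (∁ L) M₂))
      ≡⟨ cong (𝟙 (K ⊆? L) *_) (trans (𝟙-× (1 ≤? ∣ L ∣) _)
           (cong (𝟙 (1 ≤? ∣ L ∣) *_) (𝟙-× (partitionOn? L M₁) (partitionOn? (∁ L) M₂)))) ⟩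
    𝟙 (K ⊆? L) * (𝟙 (1 ≤? ∣ L ∣) * (𝟙 (partitionOn? L M₁) * 𝟙 (partitionOn? (∁ L) M₂)))
      ≡⟨ sym (*-assoc (𝟙 (K ⊆? L)) _ _) ⟩
    ab * (𝟙 (partitionOn? L M₁) * 𝟙 (partitionOn? (∁ L) M₂))
      ≡⟨ sym (*-assoc ab _ _) ⟩
    ab * 𝟙 (partitionOn? L M₁) * 𝟙 (partitionOn? (∁ L) M₂)
      ∎

P≡∑supersets : ∀ {n} (K : Subset n) → P K ≡ ∑ (subsets n) (λ L → 𝟙 (K ⊆? L) * weight n ∣ L ∣)
P≡∑supersets {n} K = begin
  P K                                                               ≡⟨ P≡admissibleTriples K ⟩
  ∑ (triples n) (λ t → 𝟙 (admissible? K t))                         ≡⟨ ∑-pairsWith _,_ (subsets n) _ _ ⟩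
  ∑ (subsets n) (λ L → ∑ (pairsWith _,_ (partReps n) (partReps n)) (λ p → 𝟙 (admissible? K (L , p))))
                                                                    ≡⟨ ∑-cong (subsets n) (admissibleTriples-over K) ⟩
  ∑ (subsets n) (λ L → 𝟙 (K ⊆? L) * weight n ∣ L ∣)                 ∎
  where open ≡-Reasoning

Σ≡∑< : ∀ a b (f : ℕ → ℕ) → Σ[ a ≤j≤ b ] f ≡ ∑< (suc b ∸ a) (λ i → f (a + i))
Σ≡∑< a b f = ∑-applyUpTo (suc b ∸ a) (λ i → i) (λ i → f (a + i))

weight-pos : ∀ n l → 1 ≤ l → weight n l ≡ Bell l * Bell (n ∸ l)
weight-pos n l 1≤l = trans (cong (_* (Bell l * Bell (n ∸ l))) (𝟙-yes 1≤l (1 ≤? l))) (*-identityˡ _)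

theorem5p14 : (n k : ℕ) → 1 ≤ n → k ≤ n → (K : Subset n) → ∣ K ∣ ≡ k →
    (k ≡ 0 → P K ≡ Σ[ 1 ≤j≤ n ] (λ j → (n C j) * Bell j * Bell (n ∸ j)))
    × (1 ≤ k → P K ≡ Σ[ 0 ≤j≤ n ∸ k ] (λ j → ((n ∸ k) C j) * Bell (k + j) * Bell (n ∸ k ∸ j)))
theorem5p14 n .(∣ K ∣) _ _ K refl = no-labelled-point , some-labelled-point
  where
  P-by-size : P K ≡ ∑< (suc (n ∸ ∣ K ∣)) (λ j → ((n ∸ ∣ K ∣) C j) * weight n (∣ K ∣ + j))
  P-by-size = trans (P≡∑supersets K) (∑-supersets n K (weight n))

  no-labelled-point : ∣ K ∣ ≡ 0 → P K ≡ Σ[ 1 ≤j≤ n ] (λ j → (n C j) * Bell j * Bell (n ∸ j))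
  no-labelled-point ∣K∣≡0 = begin
    P K                                                     ≡⟨ P-by-size ⟩
    ∑< (suc (n ∸ ∣ K ∣)) (λ j → ((n ∸ ∣ K ∣) C j) * weight n (∣ K ∣ + j))
      ≡⟨ cong (λ k → ∑< (suc (n ∸ k)) (λ j → ((n ∸ k) C j) * weight n (k + j))) ∣K∣≡0 ⟩
    ∑< n (λ j → (n C suc j) * weight n (suc j))
      ≡⟨ ∑<-cong n (λ j → trans (cong ((n C suc j) *_) (weight-pos n (suc j) (s≤s z≤n)))
                               (sym (*-assoc (n C suc j) (Bell (suc j)) (Bell (n ∸ suc j))))) ⟩
    ∑< n (λ j → (n C suc j) * Bell (suc j) * Bell (n ∸ suc j))
      ≡⟨ Σ≡∑< 1 n (λ j → (n C j) * Bell j * Bell (n ∸ j)) ⟨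
    Σ[ 1 ≤j≤ n ] (λ j → (n C j) * Bell j * Bell (n ∸ j))    ∎
    where open ≡-Reasoning

  some-labelled-point : 1 ≤ ∣ K ∣ →
    P K ≡ Σ[ 0 ≤j≤ n ∸ ∣ K ∣ ] (λ j → ((n ∸ ∣ K ∣) C j) * Bell (∣ K ∣ + j) * Bell (n ∸ ∣ K ∣ ∸ j))
  some-labelled-point 1≤∣K∣ = begin
    P K                                                     ≡⟨ P-by-size ⟩
    ∑< (suc (n ∸ ∣ K ∣)) (λ j → ((n ∸ ∣ K ∣) C j) * weight n (∣ K ∣ + j))
      ≡⟨ ∑<-cong (suc (n ∸ ∣ K ∣)) term ⟩
    ∑< (suc (n ∸ ∣ K ∣)) (λ j → ((n ∸ ∣ K ∣) C j) * Bell (∣ K ∣ + j) * Bell (n ∸ ∣ K ∣ ∸ j))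
      ≡⟨ Σ≡∑< 0 (n ∸ ∣ K ∣) (λ j → ((n ∸ ∣ K ∣) C j) * Bell (∣ K ∣ + j) * Bell (n ∸ ∣ K ∣ ∸ j)) ⟨
    Σ[ 0 ≤j≤ n ∸ ∣ K ∣ ] (λ j → ((n ∸ ∣ K ∣) C j) * Bell (∣ K ∣ + j) * Bell (n ∸ ∣ K ∣ ∸ j)) ∎
    where
    open ≡-Reasoning
    term : ∀ j → ((n ∸ ∣ K ∣) C j) * weight n (∣ K ∣ + j) ≡
                 ((n ∸ ∣ K ∣) C j) * Bell (∣ K ∣ + j) * Bell (n ∸ ∣ K ∣ ∸ j)
    term j = trans (cong (((n ∸ ∣ K ∣) C j) *_)
                         (trans (weight-pos n (∣ K ∣ + j) (≤-trans 1≤∣K∣ (m≤m+n ∣ K ∣ j)))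
                                (cong (λ l → Bell (∣ K ∣ + j) * Bell l) (sym (∸-+-assoc n ∣ K ∣ j)))))
                   (sym (*-assoc ((n ∸ ∣ K ∣) C j) (Bell (∣ K ∣ + j)) (Bell (n ∸ ∣ K ∣ ∸ j))))
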